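{- Let $G$ and $H$ be graphs such that the direct product $G\times H$ is a balanced distance magic graph, and let $\ell$ be a balanced distance magic labeling of $G\times H$ in which $(g,h)$ and $(g',h)$ are twin vertices and also $(g,h')$ and $(g'',h')$ are twin vertices, where $g''\neq g'$. Then the labeling obtained from $\ell$ by exchanging the labels of $(g',h')$ and $(g'',h')$ is a balanced distance magic labeling of $G\times H$ in which $(g,h')$ and $(g',h')$ are twin vertices.
   Context: All graphs are finite and simple; $N(x)$ is the open neighborhood of $x$. A distance magic labeling of a graph $X$ of order $n$ is a bijection $\ell\colon V(X)\to\{1,\ldots,n\}$ for which there is a positive integer $k$ with $\sum_{y\in N(x)}\ell(y)=k$ for every vertex $x$. A distance magic graph $X$ with an even number of vertices is balanced if there exists a bijection $\ell\colon V(X)\to\{1,\ldots,|V(X)|\}$ such that for every $w\in V(X)$: whenever $u\in N(w)$ has $\ell(u)=i$, there exists $v\in N(w)$ with $\ell(v)=|V(X)|+1-i$; such $\ell$ is a balanced distance magic labeling. For such a labeling, two vertices $u,v$ with $\ell(u)+\ell(v)=|V(X)|+1$ are called twin vertices (twins). The direct product $G\times H$ has vertex set $V(G)\times V(H)$, with $(g,h)$ adjacent to $(g',h')$ iff $gg'\in E(G)$ and $hh'\in E(H)$. -}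

module Defs where

open import Data.Nat using (ℕ; zero; suc; _+_; _*_; _∸_; _≤_)
open import Data.Bool using (Bool; true; false; _∧_; if_then_else_)
open import Data.Fin using (Fin; zero; suc; combine; remQuot; _≟_)
open import Data.Product using (Σ; ∃; _×_; _,_; proj₁; proj₂)
open import Relation.Binary.PropositionalEquality using (_≡_; refl; cong₂)
open import Relation.Nullary using (does)
open import Function.Definitions using (Injective)

record Graph (n : ℕ) : Set where
  field
    adj    : Fin n → Fin n → Bool
    sym    : ∀ x y → adj x y ≡ adj y x
    irrefl : ∀ x → adj x x ≡ false
open Graph public

_∈N[_]_ : {n : ℕ} → Fin n → Graph n → Fin n → Set
y ∈N[ X ] x = adj X x y ≡ true

∑ : (k : ℕ) → (Fin k → ℕ) → ℕ
∑ zero    f = 0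
∑ (suc k) f = f zero + ∑ k (λ i → f (suc i))

nbrSum : {n : ℕ} → Graph n → (Fin n → ℕ) → Fin n → ℕ
nbrSum {n} X ℓ x = ∑ n (λ y → if adj X x y then ℓ y else 0)

IsLabeling : {n : ℕ} → Graph n → (Fin n → ℕ) → Set
IsLabeling {n} X ℓ =
  Injective _≡_ _≡_ ℓ
  × (∀ v → 1 ≤ ℓ v × ℓ v ≤ n)
  × (∀ k → 1 ≤ k → k ≤ n → ∃ λ v → ℓ v ≡ k)

IsDistanceMagicLabeling : {n : ℕ} → Graph n → (Fin n → ℕ) → Set
IsDistanceMagicLabeling X ℓ =
  IsLabeling X ℓ × (∃ λ k → 1 ≤ k × (∀ x → nbrSum X ℓ x ≡ k))

IsBalancedDML : {n : ℕ} → Graph n → (Fin n → ℕ) → Set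
IsBalancedDML {n} X ℓ =
  IsDistanceMagicLabeling X ℓ
  × (∀ w u → u ∈N[ X ] w → ∃ λ v → v ∈N[ X ] w × ℓ v ≡ suc n ∸ ℓ u)

Twins : {n : ℕ} → (Fin n → ℕ) → Fin n → Fin n → Set
Twins {n} ℓ u v = ℓ u + ℓ v ≡ suc n

swapLabels : {n : ℕ} → (Fin n → ℕ) → Fin n → Fin n → (Fin n → ℕ)
swapLabels ℓ a b v =
  if does (v ≟ a) then ℓ b else (if does (v ≟ b) then ℓ a else ℓ v)

fstV : (m n : ℕ) → Fin (m * n) → Fin m
fstV m n x = proj₁ (remQuot {m} n x)

sndV : (m n : ℕ) → Fin (m * n) → Fin n
sndV m n x = proj₂ (remQuot {m} n x)

-- direct product G × H; vertex (g,h) is encoded as combine g h : Fin (m * n)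
_×ᵍ_ : {m n : ℕ} → Graph m → Graph n → Graph (m * n)
_×ᵍ_ {m} {n} G H = record { adj = A ; sym = S ; irrefl = I }
  where
  A : Fin (m * n) → Fin (m * n) → Bool
  A x y = adj G (fstV m n x) (fstV m n y) ∧ adj H (sndV m n x) (sndV m n y)
  S : ∀ x y → A x y ≡ A y x
  S x y = cong₂ _∧_ (sym G (fstV m n x) (fstV m n y)) (sym H (sndV m n x) (sndV m n y))
  I : ∀ x → A x x ≡ false
  I x with adj G (fstV m n x) (fstV m n x) | irrefl G (fstV m n x)
  ... | .false | refl = refl

-- For a balanced labelling ℓ of a graph X on N vertices, the map τ sending v
-- to the vertex labelled N+1−ℓ(v) is an involution preserving every open
-- neighbourhood, so twins have equal neighbourhoods.  Pairing each neighbour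
-- with its twin makes every neighbourhood sum a multiple of N+1, plus ℓ(u)
-- if it contains a self-twin u (2ℓ(u) = N+1); comparing N(u) with N(w) for a
-- neighbour w of u shows there are no self-twins.  Independently, exchanging
-- the labels of two vertices with equal neighbourhoods keeps a labelling
-- balanced distance magic.  In G × H the twins (g,h), (g′,h) force
-- N(g) = N(g′) in G, so (g′,h′) and (g″,h′) have the neighbourhood of
-- (g,h′); the exchange is allowed, and since (g,h′) is neither vertex (no
-- self-twins), it becomes the twin of (g′,h′).
module Submission where

open import Defs hiding (sym)
open import Data.Nat using (ℕ; zero; suc; _+_; _*_; _∸_; _≤_; _<?_; s≤s; >-nonZero)
open import Data.Nat.Properties
  using ( +-*-semiring; +-identityʳ; +-comm; +-assoc; *-zeroʳ; +-cancelʳ-≡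
        ; +-cancelˡ-≡; +-monoʳ-<; +-monoˡ-<; +-cancelˡ-<; +-cancelʳ-<; <-cmp
        ; <-irrefl; <-asym; n≤1+n; ≤-trans; m<n⇒0<n∸m; ∸-monoʳ-≤; m∸[m∸n]≡n
        ; m+n∸m≡n; m+[n∸m]≡n; n≡⌊n+n/2⌋ )
import Data.Nat as ℕ
open import Data.Nat.Divisibility using (_∣_; m∣m*n; ∣m+n∣m⇒∣n; >⇒∤)
open import Data.Nat.Tactic.RingSolver using (solve-∀)
open import Data.Bool using (Bool; true; false; if_then_else_; _∧_)
open import Data.Bool.Properties using (∧-identityʳ; ∧-conicalʳ; ⇔→≡)
open import Data.Fin using (Fin; zero; suc; combine; _≟_)
open import Data.Fin.Properties using (suc-injective; remQuot-combine; combine-injectiveˡ)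
open import Data.Fin.Permutation using (permutation)
import Data.Fin.Permutation.Components as Transposition
open import Data.Product using (∃; _×_; _,_; proj₁; proj₂)
open import Function using (_∘_; mk⇔)
open import Function.Definitions using (Injective)
open import Relation.Nullary using (¬_; does; yes; no)
open import Relation.Nullary.Decidable using (dec-true; dec-false)
open import Relation.Binary.Definitions using (tri<; tri≈; tri>)
open import Relation.Binary.PropositionalEquality
  using (_≡_; _≢_; _≗_; refl; sym; trans; cong; cong₂; subst; module ≡-Reasoning)
open import Algebra.Properties.Semiring.Sum +-*-semiring as Σ using (sum)

open ≡-Reasoning

∑≡sum : ∀ k (f : Fin k → ℕ) → ∑ k f ≡ sum f
∑≡sum zero    f = refl
∑≡sum (suc k) f = cong (f zero +_) (∑≡sum k (f ∘ suc))

∑-cong : ∀ {k} {f g : Fin k → ℕ} → f ≗ g → ∑ k f ≡ ∑ k g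
∑-cong {k} {f} {g} f≗g = begin
  ∑ k f  ≡⟨ ∑≡sum k f ⟩
  sum f  ≡⟨ Σ.sum-cong-≗ f≗g ⟩
  sum g  ≡⟨ ∑≡sum k g ⟨
  ∑ k g  ∎

∑-distrib-+ : ∀ {k} (f g : Fin k → ℕ) → ∑ k (λ y → f y + g y) ≡ ∑ k f + ∑ k g
∑-distrib-+ {k} f g = begin
  ∑ k (λ y → f y + g y)  ≡⟨ ∑≡sum k _ ⟩
  sum (λ y → f y + g y)  ≡⟨ Σ.∑-distrib-+ f g ⟩
  sum f + sum g          ≡⟨ cong₂ _+_ (∑≡sum k f) (∑≡sum k g) ⟨
  ∑ k f + ∑ k g          ∎

∑-*ˡ : ∀ {k} c (f : Fin k → ℕ) → ∑ k (λ y → c * f y) ≡ c * ∑ k f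
∑-*ˡ {k} c f = begin
  ∑ k (λ y → c * f y)  ≡⟨ ∑≡sum k _ ⟩
  sum (λ y → c * f y)  ≡⟨ Σ.*-distribˡ-sum c f ⟨
  c * sum f            ≡⟨ cong (c *_) (∑≡sum k f) ⟨
  c * ∑ k f            ∎

∑-reindex : ∀ {k} (π π⁻¹ : Fin k → Fin k) →
            (∀ y → π (π⁻¹ y) ≡ y) → (∀ y → π⁻¹ (π y) ≡ y) →
            (f : Fin k → ℕ) → ∑ k (f ∘ π) ≡ ∑ k f
∑-reindex {k} π π⁻¹ ππ⁻¹ π⁻¹π f = begin
  ∑ k (f ∘ π)  ≡⟨ ∑≡sum k _ ⟩
  sum (f ∘ π)  ≡⟨ Σ.∑-permute f (permutation π π⁻¹ ππ⁻¹ π⁻¹π) ⟨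
  sum f        ≡⟨ ∑≡sum k f ⟨
  ∑ k f        ∎

∑-zero : ∀ {k} (f : Fin k → ℕ) → (∀ y → f y ≡ 0) → ∑ k f ≡ 0
∑-zero {k} f f≡0 = begin
  ∑ k f                ≡⟨ ∑-cong f≡0 ⟩
  ∑ k (λ _ → 0)        ≡⟨ ∑≡sum k (λ _ → 0) ⟩
  sum {k} (λ _ → 0)    ≡⟨ Σ.sum-replicate-zero k ⟩
  0                    ∎

∑-single : ∀ {k} (f : Fin k → ℕ) (u : Fin k) → (∀ y → y ≢ u → f y ≡ 0) → ∑ k f ≡ f u
∑-single {suc k} f zero    f≡0 = begin
  f zero + ∑ k (f ∘ suc)  ≡⟨ cong (f zero +_) (∑-zero (f ∘ suc) (λ y → f≡0 (suc y) (λ ()))) ⟩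
  f zero + 0              ≡⟨ +-identityʳ (f zero) ⟩
  f zero                  ∎
∑-single {suc k} f (suc u) f≡0 = begin
  f zero + ∑ k (f ∘ suc)  ≡⟨ cong (_+ ∑ k (f ∘ suc)) (f≡0 zero (λ ())) ⟩
  ∑ k (f ∘ suc)           ≡⟨ ∑-single (f ∘ suc) u (λ y y≢u → f≡0 (suc y) (y≢u ∘ suc-injective)) ⟩
  f (suc u)               ∎

mask : Bool → ℕ → ℕ
mask s x = if s then x else 0

mask-zero : ∀ s → mask s 0 ≡ 0
mask-zero true  = refl
mask-zero false = refl

∑-mask-positive : ∀ {k} (s : Fin k → Bool) (f : Fin k → ℕ) →
                  1 ≤ ∑ k (λ y → mask (s y) (f y)) → ∃ λ y → s y ≡ true
∑-mask-positive {suc k} s f pos with s zero in s₀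
... | true  = zero , s₀
... | false = let (y , sy) = ∑-mask-positive (s ∘ suc) (f ∘ suc) pos in suc y , sy

lower : ℕ → ℕ → ℕ
lower M x = if does (x + x <? M) then 1 else 0

midpoint : ℕ → ℕ → ℕ
midpoint M x = if does (x + x ℕ.≟ M) then x else 0

double-injective : ∀ {x z} → x + x ≡ z + z → x ≡ z
double-injective {x} {z} x+x≡z+z =
  trans (n≡⌊n+n/2⌋ x) (trans (cong ℕ.⌊_/2⌋ x+x≡z+z) (sym (n≡⌊n+n/2⌋ z)))

midpoint-self : ∀ {M x} → x + x ≡ M → midpoint M x ≡ x
midpoint-self {M} {x} x+x≡M rewrite dec-true (x + x ℕ.≟ M) x+x≡M = refl

midpoint-other : ∀ {M x} → x + x ≢ M → midpoint M x ≡ 0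
midpoint-other {M} {x} x+x≢M rewrite dec-false (x + x ℕ.≟ M) x+x≢M = refl

-- For x ≤ M with complement y = M ∸ x: if x is below M/2 it is counted as
-- itself, if it is above then x + y contributes one M, and the midpoint is
-- counted separately.
complement-split : ∀ M x → x ≤ M →
  x + lower M (M ∸ x) * (M ∸ x) ≡ M * lower M (M ∸ x) + (lower M x * x + midpoint M x)
complement-split M x x≤M with M ∸ x | m+[n∸m]≡n x≤M
... | y | refl with <-cmp x y
... | tri< x<y _ _
  rewrite dec-true  (x + x <? x + y)     (+-monoʳ-< x x<y)
        | dec-false (y + y <? x + y)     (λ p → <-asym x<y (+-cancelʳ-< y y x p))
        | dec-false (x + x ℕ.≟ x + y)   (λ p → <-irrefl (+-cancelˡ-≡ x x y p) x<y)
  = below x y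
  where
  below : ∀ x y → x + 0 * y ≡ (x + y) * 0 + (1 * x + 0)
  below = solve-∀
... | tri≈ _ refl _
  rewrite dec-false (x + x <? x + x)     (<-irrefl refl)
        | dec-true  (x + x ℕ.≟ x + x)   refl
  = middle x
  where
  middle : ∀ x → x + 0 * x ≡ (x + x) * 0 + (0 * x + x)
  middle = solve-∀
... | tri> _ _ y<x
  rewrite dec-false (x + x <? x + y)     (λ p → <-asym y<x (+-cancelˡ-< x x y p))
        | dec-true  (y + y <? x + y)     (+-monoˡ-< y y<x)
        | dec-false (x + x ℕ.≟ x + y)   (λ p → <-irrefl (sym (+-cancelˡ-≡ x x y p)) y<x)
  = above x y
  where
  above : ∀ x y → x + 1 * y ≡ (x + y) * 1 + (0 * x + 0)
  above = solve-∀

-- Summing complement-split over s (and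
-- reindexing along τ) shows: the sum of ℓ over s is M times the number of
-- lower values in s, plus the midpoint values in s.
paired-sum : ∀ {N} M (τ : Fin N → Fin N) → (∀ y → τ (τ y) ≡ y) →
             (ℓ : Fin N → ℕ) → (∀ y → ℓ y ≤ M) → (∀ y → ℓ (τ y) ≡ M ∸ ℓ y) →
             (s : Fin N → Bool) → (∀ y → s (τ y) ≡ s y) →
             ∑ N (λ y → mask (s y) (ℓ y))
               ≡ M * ∑ N (λ y → mask (s y) (lower M (ℓ y)))
                 + ∑ N (λ y → mask (s y) (midpoint M (ℓ y)))
paired-sum {N} M τ τ² ℓ ℓ≤M ℓτ s sτ = +-cancelʳ-≡ (∑ N Low) _ _ (begin
  ∑ N F + ∑ N Low                               ≡⟨ cong (∑ N F +_) (∑-reindex τ τ τ² τ² Low) ⟨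
  ∑ N F + ∑ N (Low ∘ τ)                         ≡⟨ ∑-distrib-+ F (Low ∘ τ) ⟨
  ∑ N (λ y → F y + Low (τ y))                   ≡⟨ ∑-cong pointwise ⟩
  ∑ N (λ y → M * C (τ y) + (Low y + Mid y))     ≡⟨ ∑-distrib-+ (λ y → M * C (τ y)) _ ⟩
  ∑ N (λ y → M * C (τ y)) + ∑ N (λ y → Low y + Mid y)
    ≡⟨ cong₂ _+_ (trans (∑-*ˡ M (C ∘ τ)) (cong (M *_) (∑-reindex τ τ τ² τ² C)))
                 (trans (∑-distrib-+ Low Mid) (+-comm (∑ N Low) (∑ N Mid))) ⟩
  M * ∑ N C + (∑ N Mid + ∑ N Low)               ≡⟨ +-assoc (M * ∑ N C) (∑ N Mid) (∑ N Low) ⟨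
  M * ∑ N C + ∑ N Mid + ∑ N Low                 ∎)
  where
  F C Low Mid : Fin N → ℕ
  F y   = mask (s y) (ℓ y)
  C y   = mask (s y) (lower M (ℓ y))
  Low y = C y * ℓ y
  Mid y = mask (s y) (midpoint M (ℓ y))

  pointwise : ∀ y → F y + Low (τ y) ≡ M * C (τ y) + (Low y + Mid y)
  pointwise y rewrite sτ y | ℓτ y with s y
  ... | true  = complement-split M (ℓ y) (ℓ≤M y)
  ... | false = sym (trans (+-identityʳ (M * 0)) (*-zeroʳ M))

SameNbhd : ∀ {N} → Graph N → Fin N → Fin N → Set
SameNbhd X a b = ∀ x → adj X x a ≡ adj X x b

swapLabels≗ : ∀ {N} (ℓ : Fin N → ℕ) (a b : Fin N) →
              swapLabels ℓ a b ≗ ℓ ∘ Transposition.transpose a b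
swapLabels≗ ℓ a b v with does (v ≟ a)
... | true  = refl
... | false with does (v ≟ b)
...   | true  = refl
...   | false = refl

swapLabels-first : ∀ {N} (ℓ : Fin N → ℕ) (a b : Fin N) → swapLabels ℓ a b a ≡ ℓ b
swapLabels-first ℓ a b rewrite dec-true (a ≟ a) refl = refl

swapLabels-other : ∀ {N} (ℓ : Fin N → ℕ) {a b v : Fin N} → v ≢ a → v ≢ b →
                   swapLabels ℓ a b v ≡ ℓ v
swapLabels-other ℓ {a} {b} {v} v≢a v≢b rewrite dec-false (v ≟ a) v≢a | dec-false (v ≟ b) v≢b = refl

adj-transpose : ∀ {N} (X : Graph N) {a b} → SameNbhd X a b →
                ∀ x v → adj X x (Transposition.transpose a b v) ≡ adj X x v
adj-transpose X {a} {b} a∼b x v with v ≟ a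
... | yes refl = sym (a∼b x)
... | no _ with v ≟ b
...   | yes refl = a∼b x
...   | no _     = refl

-- Exchanging the labels of two vertices with the same open neighbourhood
-- keeps a labelling balanced distance magic: it permutes labels within
-- every open neighbourhood.
swap-balanced : ∀ {N} (X : Graph N) (ℓ : Fin N → ℕ) {a b} → SameNbhd X a b →
                IsBalancedDML X ℓ → IsBalancedDML X (swapLabels ℓ a b)
swap-balanced {N} X ℓ {a} {b} a∼b (((inj , range , onto) , k , k≥1 , magic) , balanced) =
  ((inj′ , range′ , onto′) , k , k≥1 , magic′) , balanced′
  where
  t t⁻¹ : Fin N → Fin N
  t   = Transposition.transpose a b
  t⁻¹ = Transposition.transpose b a

  t⁻¹∘t : ∀ v → t⁻¹ (t v) ≡ v
  t⁻¹∘t v = Transposition.transpose-inverse b a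
  t∘t⁻¹ : ∀ v → t (t⁻¹ v) ≡ v
  t∘t⁻¹ v = Transposition.transpose-inverse a b

  ℓ′ : Fin N → ℕ
  ℓ′ = swapLabels ℓ a b

  inj′ : Injective _≡_ _≡_ ℓ′
  inj′ {x} {y} ℓ′x≡ℓ′y = begin
    x          ≡⟨ t⁻¹∘t x ⟨
    t⁻¹ (t x)  ≡⟨ cong t⁻¹ (inj (trans (sym (swapLabels≗ ℓ a b x)) (trans ℓ′x≡ℓ′y (swapLabels≗ ℓ a b y)))) ⟩
    t⁻¹ (t y)  ≡⟨ t⁻¹∘t y ⟩
    y          ∎

  range′ : ∀ v → 1 ≤ ℓ′ v × ℓ′ v ≤ N
  range′ v = subst (λ i → 1 ≤ i × i ≤ N) (sym (swapLabels≗ ℓ a b v)) (range (t v))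

  onto′ : ∀ i → 1 ≤ i → i ≤ N → ∃ λ v → ℓ′ v ≡ i
  onto′ i 1≤i i≤N =
    let (v , ℓv≡i) = onto i 1≤i i≤N
    in t⁻¹ v , trans (swapLabels≗ ℓ a b (t⁻¹ v)) (trans (cong ℓ (t∘t⁻¹ v)) ℓv≡i)

  magic′ : ∀ x → nbrSum X ℓ′ x ≡ k
  magic′ x = begin
    ∑ N (λ y → mask (adj X x y) (ℓ′ y))         ≡⟨ ∑-cong (λ y → cong₂ mask (sym (adj-transpose X a∼b x y)) (swapLabels≗ ℓ a b y)) ⟩
    ∑ N (λ y → mask (adj X x (t y)) (ℓ (t y)))  ≡⟨ ∑-reindex t t⁻¹ t∘t⁻¹ t⁻¹∘t (λ y → mask (adj X x y) (ℓ y)) ⟩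
    nbrSum X ℓ x                                 ≡⟨ magic x ⟩
    k                                            ∎

  balanced′ : ∀ w u → u ∈N[ X ] w → ∃ λ v → v ∈N[ X ] w × ℓ′ v ≡ suc N ∸ ℓ′ u
  balanced′ w u u∈Nw =
    let (v , v∈Nw , ℓv≡) = balanced w (t u) (trans (adj-transpose X a∼b w u) u∈Nw)
    in t⁻¹ v ,
       trans (adj-transpose X (λ x → sym (a∼b x)) w v) v∈Nw ,
       (begin
         ℓ′ (t⁻¹ v)       ≡⟨ swapLabels≗ ℓ a b (t⁻¹ v) ⟩
         ℓ (t (t⁻¹ v))    ≡⟨ cong ℓ (t∘t⁻¹ v) ⟩
         ℓ v              ≡⟨ ℓv≡ ⟩
         suc N ∸ ℓ (t u)  ≡⟨ cong (suc N ∸_) (swapLabels≗ ℓ a b u) ⟨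
         suc N ∸ ℓ′ u     ∎)

-- In a distance magic graph every vertex has a neighbour, because the
-- magic constant is positive.
has-neighbour : ∀ {N} (X : Graph N) (ℓ : Fin N → ℕ) →
                IsDistanceMagicLabeling X ℓ → ∀ x → ∃ λ y → y ∈N[ X ] x
has-neighbour X ℓ (_ , k , k≥1 , magic) x =
  ∑-mask-positive (adj X x) ℓ (subst (1 ≤_) (sym (magic x)) k≥1)

module TwinInvolution {N : ℕ} (X : Graph N) (ℓ : Fin N → ℕ) (B : IsBalancedDML X ℓ) where

  private
    inj : Injective _≡_ _≡_ ℓ
    inj = proj₁ (proj₁ (proj₁ B))

    range : ∀ v → 1 ≤ ℓ v × ℓ v ≤ N
    range = proj₁ (proj₂ (proj₁ (proj₁ B)))

    onto : ∀ i → 1 ≤ i → i ≤ N → ∃ λ v → ℓ v ≡ i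
    onto = proj₂ (proj₂ (proj₁ (proj₁ B)))

    ℓ≤1+N : ∀ v → ℓ v ≤ suc N
    ℓ≤1+N v = ≤-trans (proj₂ (range v)) (n≤1+n N)

    complement : ∀ v → ∃ λ w → ℓ w ≡ suc N ∸ ℓ v
    complement v = onto (suc N ∸ ℓ v) (m<n⇒0<n∸m (s≤s (proj₂ (range v))))
                                      (∸-monoʳ-≤ (suc N) (proj₁ (range v)))

  τ : Fin N → Fin N
  τ v = proj₁ (complement v)

  ℓ∘τ : ∀ v → ℓ (τ v) ≡ suc N ∸ ℓ v
  ℓ∘τ v = proj₂ (complement v)

  τ-involutive : ∀ v → τ (τ v) ≡ v
  τ-involutive v = inj (begin
    ℓ (τ (τ v))            ≡⟨ ℓ∘τ (τ v) ⟩
    suc N ∸ ℓ (τ v)        ≡⟨ cong (suc N ∸_) (ℓ∘τ v) ⟩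
    suc N ∸ (suc N ∸ ℓ v)  ≡⟨ m∸[m∸n]≡n (ℓ≤1+N v) ⟩
    ℓ v                    ∎)

  twin≡τ : ∀ {p q} → Twins ℓ p q → q ≡ τ p
  twin≡τ {p} {q} twins = inj (begin
    ℓ q                  ≡⟨ m+n∸m≡n (ℓ p) (ℓ q) ⟨
    ℓ p + ℓ q ∸ ℓ p      ≡⟨ cong (_∸ ℓ p) twins ⟩
    suc N ∸ ℓ p          ≡⟨ ℓ∘τ p ⟨
    ℓ (τ p)              ∎)

  -- Balancedness says exactly that open neighbourhoods are closed under τ.
  τ-closed : ∀ w y → y ∈N[ X ] w → τ y ∈N[ X ] w
  τ-closed w y y∈Nw =
    let (v , v∈Nw , ℓv≡) = proj₂ B w y y∈Nw
    in subst (_∈N[ X ] w) (inj (trans ℓv≡ (sym (ℓ∘τ y)))) v∈Nw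

  adj-τ : ∀ w y → adj X w (τ y) ≡ adj X w y
  adj-τ w y = ⇔→≡ (mk⇔ (λ τy∈Nw → subst (_∈N[ X ] w) (τ-involutive y) (τ-closed w (τ y) τy∈Nw))
                       (τ-closed w y))

  twins-sameNbhd : ∀ {p q} → Twins ℓ p q → SameNbhd X p q
  twins-sameNbhd {p} twins x = trans (sym (adj-τ x p)) (cong (adj X x) (sym (twin≡τ twins)))

  lowerCount : Fin N → ℕ
  lowerCount w = ∑ N (λ y → mask (adj X w y) (lower (suc N) (ℓ y)))

  -- If u is a self-twin, every neighbourhood sum is a multiple of N+1,
  -- plus ℓ u when the neighbourhood contains u (u is the only midpoint).
  nbrSum-self-twin : ∀ u → Twins ℓ u u →
                     ∀ w → nbrSum X ℓ w ≡ suc N * lowerCount w + mask (adj X w u) (ℓ u)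
  nbrSum-self-twin u self w =
    trans (paired-sum (suc N) τ τ-involutive ℓ ℓ≤1+N ℓ∘τ (adj X w) (adj-τ w))
          (cong (suc N * lowerCount w +_) midpoints)
    where
    other-midpoint : ∀ y → y ≢ u → mask (adj X w y) (midpoint (suc N) (ℓ y)) ≡ 0
    other-midpoint y y≢u =
      trans (cong (mask (adj X w y))
                  (midpoint-other {x = ℓ y} λ y-self → y≢u (inj (double-injective (trans y-self (sym self))))))
            (mask-zero (adj X w y))

    midpoints : ∑ N (λ y → mask (adj X w y) (midpoint (suc N) (ℓ y))) ≡ mask (adj X w u) (ℓ u)
    midpoints = trans (∑-single _ u other-midpoint) (cong (mask (adj X w u)) (midpoint-self self))

  -- A balanced labelling has no self-twin: for a neighbour w of u, the
  -- sums over N(u) ∌ u and N(w) ∋ u would differ by ℓ u modulo N+1.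
  no-self-twin : ∀ u → ¬ Twins ℓ u u
  no-self-twin u self = >⇒∤ {{>-nonZero (proj₁ (range u))}} (s≤s (proj₂ (range u))) N+1∣ℓu
    where
    magic : ∀ x → nbrSum X ℓ x ≡ proj₁ (proj₂ (proj₁ B))
    magic = proj₂ (proj₂ (proj₂ (proj₁ B)))

    w : Fin N
    w = proj₁ (has-neighbour X ℓ (proj₁ B) u)

    u∈Nw : u ∈N[ X ] w
    u∈Nw = trans (Graph.sym X w u) (proj₂ (has-neighbour X ℓ (proj₁ B) u))

    sums-agree : suc N * lowerCount u ≡ suc N * lowerCount w + ℓ u
    sums-agree = begin
      suc N * lowerCount u                                 ≡⟨ +-identityʳ _ ⟨
      suc N * lowerCount u + mask false (ℓ u)              ≡⟨ cong (λ s → suc N * lowerCount u + mask s (ℓ u)) (irrefl X u) ⟨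
      suc N * lowerCount u + mask (adj X u u) (ℓ u)        ≡⟨ nbrSum-self-twin u self u ⟨
      nbrSum X ℓ u                                         ≡⟨ trans (magic u) (sym (magic w)) ⟩
      nbrSum X ℓ w                                         ≡⟨ nbrSum-self-twin u self w ⟩
      suc N * lowerCount w + mask (adj X w u) (ℓ u)        ≡⟨ cong (λ s → suc N * lowerCount w + mask s (ℓ u)) u∈Nw ⟩
      suc N * lowerCount w + ℓ u                           ∎

    N+1∣ℓu : suc N ∣ ℓ u
    N+1∣ℓu = ∣m+n∣m⇒∣n (subst (suc N ∣_) sums-agree (m∣m*n (lowerCount u))) (m∣m*n (lowerCount w))

adj-×-combine : ∀ {m n} (G : Graph m) (H : Graph n) z p q →
                adj (G ×ᵍ H) z (combine p q) ≡ adj G (fstV m n z) p ∧ adj H (sndV m n z) q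
adj-×-combine {m} {n} G H z p q =
  cong (λ (p′ , q′) → adj G (fstV m n z) p′ ∧ adj H (sndV m n z) q′) (remQuot-combine p q)

adj-combine-combine : ∀ {m n} (G : Graph m) (H : Graph n) x y p q →
                      adj (G ×ᵍ H) (combine x y) (combine p q) ≡ adj G x p ∧ adj H y q
adj-combine-combine G H x y p q =
  trans (adj-×-combine G H (combine x y) p q)
        (cong (λ (x′ , y′) → adj G x′ p ∧ adj H y′ q) (remQuot-combine x y))

neighbour-project : ∀ {m n} (G : Graph m) (H : Graph n) g h z →
                    z ∈N[ G ×ᵍ H ] combine g h → h ∈N[ H ] sndV m n z
neighbour-project G H g h z z∈N =
  ∧-conicalʳ _ _ (trans (sym (adj-×-combine G H z g h))
                        (trans (Graph.sym (G ×ᵍ H) z (combine g h)) z∈N))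

sameNbhd-lift : ∀ {m n} (G : Graph m) (H : Graph n) {g g′} → SameNbhd G g g′ →
                ∀ h → SameNbhd (G ×ᵍ H) (combine g h) (combine g′ h)
sameNbhd-lift {m} {n} G H {g} {g′} g∼g′ h z = begin
  adj (G ×ᵍ H) z (combine g h)                 ≡⟨ adj-×-combine G H z g h ⟩
  adj G (fstV m n z) g ∧ adj H (sndV m n z) h   ≡⟨ cong (_∧ adj H (sndV m n z) h) (g∼g′ (fstV m n z)) ⟩
  adj G (fstV m n z) g′ ∧ adj H (sndV m n z) h  ≡⟨ adj-×-combine G H z g′ h ⟨
  adj (G ×ᵍ H) z (combine g′ h)                ∎

sameNbhd-project : ∀ {m n} (G : Graph m) (H : Graph n) {g g′ h y} →
                   SameNbhd (G ×ᵍ H) (combine g h) (combine g′ h) → h ∈N[ H ] y →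
                   SameNbhd G g g′
sameNbhd-project G H {g} {g′} {h} {y} same h∈Ny x = begin
  adj G x g                            ≡⟨ ∧-identityʳ (adj G x g) ⟨
  adj G x g ∧ true                     ≡⟨ cong (adj G x g ∧_) h∈Ny ⟨
  adj G x g ∧ adj H y h                ≡⟨ adj-combine-combine G H x y g h ⟨
  adj (G ×ᵍ H) (combine x y) (combine g h)   ≡⟨ same (combine x y) ⟩
  adj (G ×ᵍ H) (combine x y) (combine g′ h)  ≡⟨ adj-combine-combine G H x y g′ h ⟩
  adj G x g′ ∧ adj H y h               ≡⟨ cong (adj G x g′ ∧_) h∈Ny ⟩
  adj G x g′ ∧ true                    ≡⟨ ∧-identityʳ (adj G x g′) ⟩
  adj G x g′                           ∎

lemma2p4 : {m n : ℕ} (G : Graph m) (H : Graph n) (ℓ : Fin (m * n) → ℕ)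
           (g g′ g″ : Fin m) (h h′ : Fin n) →
           IsBalancedDML (G ×ᵍ H) ℓ →
           Twins ℓ (combine g h) (combine g′ h) →
           Twins ℓ (combine g h′) (combine g″ h′) →
           g″ ≢ g′ →
           IsBalancedDML (G ×ᵍ H) (swapLabels ℓ (combine g′ h′) (combine g″ h′))
           × Twins (swapLabels ℓ (combine g′ h′) (combine g″ h′)) (combine g h′) (combine g′ h′)
lemma2p4 {m} {n} G H ℓ g g′ g″ h h′ B twins-h twins-h′ _ = swap-balanced X ℓ a∼b B , twins-after
  where
  open TwinInvolution (G ×ᵍ H) ℓ B using (twins-sameNbhd; no-self-twin)
  X : Graph (m * n)
  X = G ×ᵍ H

  a b c : Fin (m * n)
  a = combine g′ h′
  b = combine g″ h′
  c = combine g h′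

  -- h has a neighbour, so the twins (g,h), (g′,h) force N(g) = N(g′) in G.
  g∼g′ : SameNbhd G g g′
  g∼g′ = let (z , z∈N) = has-neighbour X ℓ (proj₁ B) (combine g h)
         in sameNbhd-project G H (twins-sameNbhd twins-h) (neighbour-project G H g h z z∈N)

  a∼b : SameNbhd X a b
  a∼b x = trans (sym (sameNbhd-lift G H g∼g′ h′ x)) (twins-sameNbhd twins-h′ x)

  -- c = a or c = b would make (g,h) resp. (g,h′) a self-twin.
  c≢a : c ≢ a
  c≢a c≡a = no-self-twin (combine g h)
    (subst (λ g₀ → Twins ℓ (combine g h) (combine g₀ h)) (sym (combine-injectiveˡ g h′ g′ h′ c≡a)) twins-h)

  c≢b : c ≢ b
  c≢b c≡b = no-self-twin c
    (subst (λ g₀ → Twins ℓ c (combine g₀ h′)) (sym (combine-injectiveˡ g h′ g″ h′ c≡b)) twins-h′)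

  twins-after : Twins (swapLabels ℓ a b) c a
  twins-after = trans (cong₂ _+_ (swapLabels-other ℓ c≢a c≢b) (swapLabels-first ℓ a b)) twins-h′
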